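{- Let $J'\subseteq J$ be a set of jobs and $t\ge 0$. Then there exists a procedure that finds a partial potential schedule of $J'$ starting at time $t$; in particular, such a schedule exists.
   Context: $J$ is a finite set of jobs; job $j$ has processing time $p_j>0$ and weight $w_j>0$. A schedule of $J'\subseteq J$ starting at time $t\ge0$ processes the jobs of $J'$ in some order consecutively without idle time from $t$; $t_j$ is the (absolute) start time of $j$. For $s\ge0$, $\varphi_j(s)=\frac{w_j}{p_j(p_j+s)}$. For distinct jobs $i,j$ with $w_ip_j\neq w_jp_i$, $t^*_{ij}=t^*_{ji}=\frac{w_jp_i^2-w_ip_j^2}{w_ip_j-w_jp_i}$, the unique real $s$ with $\varphi_i(s)=\varphi_j(s)$. Dominance rule. For distinct jobs $i,j$: (a) if $\varphi_i(s)\ge\varphi_j(s)$ for all $s\ge0$ and $\varphi_i\not\equiv\varphi_j$, the rule imposes "$i\prec_g j$", which a schedule violates if $j$ is processed before $i$; (b) if neither $\varphi_i\ge\varphi_j$ nor $\varphi_j\ge\varphi_i$ holds on all of $[0,\infty)$, then $t^*_{ij}>0$, and naming the jobs so that $\varphi_i(0)>\varphi_j(0)$, the rule imposes "$i\prec_{g[0,t^*_{ij})}j$", violated if $j$ is processed before $i$ and $t_i-p_j<t^*_{ij}$, and "$j\prec_{g[t^*_{ij},\infty)}i$", violated if $i$ is processed before $j$ and $t_i\ge t^*_{ij}$. A schedule of $J'$ is a partial potential schedule if no pair of jobs of $J'$ violates a relation imposed by the rule.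
   Formalization: The processing times $p_j$, weights $w_j$, start time $t$ and the argument $s$ of $\varphi_j$ are rational instead of real. -}

module Defs where

open import Data.Nat using (ℕ; zero; suc)
open import Data.Fin using (Fin; zero; suc) renaming (_<_ to _<ᶠ_; _<?_ to _<ᶠ?_)
open import Data.Fin.Permutation using (Permutation′; _⟨$⟩ʳ_)
open import Data.Rational
  using (ℚ; 0ℚ; _+_; _*_; _-_; _÷_; _<_; _≤_; _>_; _≥_; positive; nonNegative; ≢-nonZero)
open import Data.Rational.Properties using (pos*pos⇒pos; pos+nonNeg⇒pos; ≤-refl; pos⇒nonZero)
open import Data.Bool using (if_then_else_)
open import Relation.Nullary using (does)
open import Data.Product using (_×_)
open import Relation.Binary.PropositionalEquality using (_≡_; _≢_)
open import Relation.Nullary using (¬_)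

finSum : {n : ℕ} → (Fin n → ℚ) → ℚ
finSum {zero}  f = 0ℚ
finSum {suc n} f = f zero + finSum (λ k → f (suc k))

-- A job set J' indexed by Fin n, with processing times p, weights w,
-- and start time t of the schedule.
module Jobs (n : ℕ) (p w : Fin n → ℚ) (p>0 : ∀ j → 0ℚ < p j) where

  φ : Fin n → (s : ℚ) → 0ℚ ≤ s → ℚ
  φ j s s≥0 =
    (w j ÷ (p j * (p j + s)))
      {{pos⇒nonZero (p j * (p j + s))
         {{pos*pos⇒pos (p j) {{positive (p>0 j)}} (p j + s)
            {{pos+nonNeg⇒pos (p j) {{positive (p>0 j)}} s {{nonNegative s≥0}}}}}}}}

  DomAll : Fin n → Fin n → Set
  DomAll i j = ∀ s (s≥0 : 0ℚ ≤ s) → φ j s s≥0 ≤ φ i s s≥0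

  SameφOnNonNeg : Fin n → Fin n → Set
  SameφOnNonNeg i j = ∀ s (s≥0 : 0ℚ ≤ s) → φ i s s≥0 ≡ φ j s s≥0

  tstar : (i j : Fin n) → (w i * p j - w j * p i) ≢ 0ℚ → ℚ
  tstar i j h =
    ((w j * (p i * p i) - w i * (p j * p j)) ÷ (w i * p j - w j * p i)) {{≢-nonZero h}}

  φ0 : Fin n → ℚ
  φ0 j = φ j 0ℚ (≤-refl {0ℚ})

  -- A schedule of J' starting at time t: an ordering of the jobs, given by a
  -- permutation π sending each job to its position; jobs are processed in order
  -- of position, consecutively without idle time from t.
  module Schedule (t : ℚ) (π : Permutation′ n) where

    pos : Fin n → Fin n
    pos j = π ⟨$⟩ʳ j

    Before : Fin n → Fin n → Set
    Before a b = pos a <ᶠ pos b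

    start : Fin n → ℚ
    start j = t + finSum (λ k → if does (pos k <ᶠ? pos j) then p k else 0ℚ)

    IsPartialPotential : Set
    IsPartialPotential = ∀ i j → i ≢ j →
        (DomAll i j → ¬ SameφOnNonNeg i j → ¬ Before j i)
      ×
        (¬ DomAll i j → ¬ DomAll j i → φ0 j < φ0 i →
          (h : (w i * p j - w j * p i) ≢ 0ℚ) →
              (Before j i → ¬ (start i - p j < tstar i j h))
            × (Before i j → ¬ (tstar i j h ≤ start i)))

{-# OPTIONS --safe #-}
module Submission where

-- Schedule greedily: at each start time τ run a job maximising φ_j(τ), breaking ties in favour
-- of the longer job. Cross-multiplying, φ_i(s) − φ_j(s) has the sign of the affine function
-- g(s) = (w_i p_j − w_j p_i) s − (w_j p_i² − w_i p_j²), whose root is t*_ij. When g(0) > 0 and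
-- g is not nonnegative on [0, ∞), its slope is negative, so g(τ) ≤ 0 exactly when τ ≥ t*_ij:
-- hence if j is chosen before i then t*_ij ≤ t_j ≤ t_i − p_j, and if i is chosen first then
-- t_i < t*_ij, an exact tie at t*_ij being resolved in favour of j by the tie-break. Under
-- dominance, j can only be chosen before i at a tie, and the tie-break then forces g ≡ 0.

open import Defs
open import Level using (0ℓ)
open import Function using (_∘_)
open import Data.Nat using (ℕ; zero; suc)
import Data.Nat as ℕ
import Data.Nat.Properties as ℕ
open import Data.Fin using (Fin; zero; suc; punchIn) renaming (_<_ to _<ᶠ_; _<?_ to _<ᶠ?_)
open import Data.Fin.Properties using (punchIn-punchOut) renaming (_≟_ to _≟ᶠ_)
open import Data.Fin.Permutation
  using (Permutation; Permutation′; _⟨$⟩ʳ_; insert; insert-punchIn; id)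
open import Data.Rational
  using (ℚ; 0ℚ; 1ℚ; _+_; _*_; _-_; -_; _÷_; 1/_; _<_; _≤_; NonZero; Positive; NonNegative;
         Negative; NonPositive; positive; nonNegative; negative; ≢-nonZero)
open import Data.Rational.Properties
open import Data.Rational.Solver using (module +-*-Solver)
open import Algebra.Properties.Group +-0-group
  using (//-rightDividesˡ; //-rightDividesʳ; x∙y⁻¹≈ε⇒x≈y; x≈y⇒x∙y⁻¹≈ε)
open import Data.Bool using (if_then_else_)
open import Data.Empty using (⊥-elim)
open import Data.Sum using (inj₁; inj₂; reduce)
open import Data.Product using (Σ; ∃-syntax; _×_; _,_; proj₁; map₂)
open import Data.Product.Relation.Binary.Lex.Strict using (×-Lex; ×-transitive; ×-total₂)
open import Relation.Binary.Core using (Rel)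
open import Relation.Binary.Definitions using (Transitive; Total)
open import Relation.Binary.PropositionalEquality
open import Relation.Nullary using (¬_; does; yes; no)
open +-*-Solver

<⇒≱ : ∀ {p q} → p < q → ¬ q ≤ p
<⇒≱ p<q q≤p = <-irrefl refl (<-≤-trans p<q q≤p)

*-positive : ∀ {p q} → 0ℚ < p → 0ℚ < q → 0ℚ < p * q
*-positive {p} {q} 0<p 0<q =
  positive⁻¹ (p * q) {{pos*pos⇒pos p {{positive 0<p}} q {{positive 0<q}}}}

p≤q⇒0≤q-p : ∀ {p q} → p ≤ q → 0ℚ ≤ q - p
p≤q⇒0≤q-p {p} {q} p≤q = subst (_≤ q - p) (+-inverseʳ p) (+-monoˡ-≤ (- p) p≤q)

0≤q-p⇒p≤q : ∀ {p q} → 0ℚ ≤ q - p → p ≤ q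
0≤q-p⇒p≤q {p} {q} 0≤q-p = subst₂ _≤_ (+-identityˡ p) (//-rightDividesˡ p q) (+-monoˡ-≤ p 0≤q-p)

p<q⇒0<q-p : ∀ {p q} → p < q → 0ℚ < q - p
p<q⇒0<q-p {p} {q} p<q = subst (_< q - p) (+-inverseʳ p) (+-monoˡ-< (- p) p<q)

0<q-p⇒p<q : ∀ {p q} → 0ℚ < q - p → p < q
0<q-p⇒p<q {p} {q} 0<q-p = subst₂ _<_ (+-identityˡ p) (//-rightDividesˡ p q) (+-monoˡ-< p 0<q-p)

p≤q⇒p-q≤0 : ∀ {p q} → p ≤ q → p - q ≤ 0ℚ
p≤q⇒p-q≤0 {p} {q} p≤q = subst (p - q ≤_) (+-inverseʳ q) (+-monoˡ-≤ (- q) p≤q)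

p-q≤0⇒p≤q : ∀ {p q} → p - q ≤ 0ℚ → p ≤ q
p-q≤0⇒p≤q {p} {q} p-q≤0 = subst₂ _≤_ (//-rightDividesˡ q p) (+-identityˡ q) (+-monoˡ-≤ q p-q≤0)

p+q≤r⇒p≤r-q : ∀ {p q r} → p + q ≤ r → p ≤ r - q
p+q≤r⇒p≤r-q {p} {q} {r} p+q≤r = subst (_≤ r - q) (//-rightDividesʳ q p) (+-monoˡ-≤ (- q) p+q≤r)

p≤p+q : ∀ {p q} → 0ℚ ≤ q → p ≤ p + q
p≤p+q {p} {q} 0≤q = subst (_≤ p + q) (+-identityʳ p) (+-monoʳ-≤ p 0≤q)

p÷q*q≡p : ∀ p q .{{_ : NonZero q}} → (p ÷ q) * q ≡ p
p÷q*q≡p p q = trans (*-assoc p (1/ q) q) (trans (cong (p *_) (*-inverseˡ q)) (*-identityʳ p))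

*-balance⇒≤ : ∀ {α β x y} → 0ℚ ≤ β → 0ℚ < x → y ≤ x → α * x ≡ β * y → α ≤ β
*-balance⇒≤ {α} {β} {x} {y} 0≤β 0<x y≤x αx≡βy = ≮⇒≥ λ β<α → <-irrefl (sym αx≡βy) (begin-strict
    β * y  ≤⟨ *-monoˡ-≤-nonNeg β {{nonNegative 0≤β}} y≤x ⟩
    β * x  <⟨ *-monoˡ-<-pos x {{positive 0<x}} β<α ⟩
    α * x  ∎)
  where open ≤-Reasoning

module SignOfScaledDifference {x y D g : ℚ} (0<D : 0ℚ < D) (g≡ : g ≡ x * D - y * D) where

  private instance
    D-positive : Positive D
    D-positive = positive 0<D
    D-nonNegative : NonNegative D
    D-nonNegative = pos⇒nonNeg D

  y≤x⇒0≤g : y ≤ x → 0ℚ ≤ g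
  y≤x⇒0≤g y≤x = subst (0ℚ ≤_) (sym g≡) (p≤q⇒0≤q-p (*-monoʳ-≤-nonNeg D y≤x))

  0≤g⇒y≤x : 0ℚ ≤ g → y ≤ x
  0≤g⇒y≤x 0≤g = *-cancelʳ-≤-pos D (0≤q-p⇒p≤q (subst (0ℚ ≤_) g≡ 0≤g))

  y<x⇒0<g : y < x → 0ℚ < g
  y<x⇒0<g y<x = subst (0ℚ <_) (sym g≡) (p<q⇒0<q-p (*-monoˡ-<-pos D y<x))

  x≤y⇒g≤0 : x ≤ y → g ≤ 0ℚ
  x≤y⇒g≤0 x≤y = subst (_≤ 0ℚ) (sym g≡) (p≤q⇒p-q≤0 (*-monoʳ-≤-nonNeg D x≤y))

  g≤0⇒x≤y : g ≤ 0ℚ → x ≤ y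
  g≤0⇒x≤y g≤0 = *-cancelʳ-≤-pos D (p-q≤0⇒p≤q (subst (_≤ 0ℚ) g≡ g≤0))

  x≡y⇒g≡0 : x ≡ y → g ≡ 0ℚ
  x≡y⇒g≡0 x≡y = trans g≡ (x≈y⇒x∙y⁻¹≈ε (cong (_* D) x≡y))

  g≡0⇒x≡y : g ≡ 0ℚ → x ≡ y
  g≡0⇒x≡y g≡0 = ≤-antisym (g≤0⇒x≤y (≤-reflexive g≡0)) (0≤g⇒y≤x (≤-reflexive (sym g≡0)))

module Line (c N : ℚ) where

  line-mono-≤ : ∀ {s s′} → 0ℚ ≤ c → s ≤ s′ → c * s - N ≤ c * s′ - N
  line-mono-≤ 0≤c s≤s′ = +-monoˡ-≤ (- N) (*-monoˡ-≤-nonNeg c {{nonNegative 0≤c}} s≤s′)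

  sign-change⇒slope<0 : ∀ {τ} → 0ℚ < c * 0ℚ - N → 0ℚ ≤ τ → c * τ - N ≤ 0ℚ → c < 0ℚ
  sign-change⇒slope<0 0<g0 0≤τ gτ≤0 =
    ≰⇒> λ 0≤c → <⇒≱ 0<g0 (≤-trans (line-mono-≤ 0≤c 0≤τ) gτ≤0)

  ¬nonNeg⇒slope<0 : 0ℚ < c * 0ℚ - N → ¬ (∀ s → 0ℚ ≤ s → 0ℚ ≤ c * s - N) → c < 0ℚ
  ¬nonNeg⇒slope<0 0<g0 ¬nonNeg =
    ≰⇒> λ 0≤c → ¬nonNeg λ s 0≤s → ≤-trans (<⇒≤ 0<g0) (line-mono-≤ 0≤c 0≤s)

  nonNeg∧vanishing⇒≡0 : ∀ {τ} → (∀ s → 0ℚ ≤ s → 0ℚ ≤ c * s - N) → c ≤ 0ℚ → 0ℚ ≤ τ →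
                        c * τ - N ≡ 0ℚ → ∀ s → c * s - N ≡ 0ℚ
  nonNeg∧vanishing⇒≡0 {τ} nonNeg c≤0 0≤τ gτ≡0 s = begin
      c * s - N   ≡⟨ cong (λ a → a * s - N) c≡0 ⟩
      0ℚ * s - N  ≡⟨ cong (_- N) (trans (*-zeroˡ s) (sym (*-zeroˡ τ))) ⟩
      0ℚ * τ - N  ≡⟨ cong (λ a → a * τ - N) (sym c≡0) ⟩
      c * τ - N   ≡⟨ gτ≡0 ⟩
      0ℚ          ∎
    where
    open ≡-Reasoning
    g[τ+1]≡c : c * (τ + 1ℚ) - N ≡ c
    g[τ+1]≡c = begin
      c * (τ + 1ℚ) - N  ≡⟨ solve 3 (λ c τ N → c :* (τ :+ con 1ℚ) :- N := c :* τ :- N :+ c) refl c τ N ⟩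
      (c * τ - N) + c   ≡⟨ cong (_+ c) gτ≡0 ⟩
      0ℚ + c            ≡⟨ +-identityˡ c ⟩
      c                 ∎
    c≡0 : c ≡ 0ℚ
    c≡0 = ≤-antisym c≤0
      (subst (0ℚ ≤_) g[τ+1]≡c (nonNeg (τ + 1ℚ) (+-mono-≤ 0≤τ (nonNegative⁻¹ 1ℚ))))

  module _ .{{_ : NonZero c}} (c<0 : c < 0ℚ) where

    private instance
      c-negative : Negative c
      c-negative = negative c<0
      c-nonPositive : NonPositive c
      c-nonPositive = neg⇒nonPos c

    c*[N÷c]≡N : c * (N ÷ c) ≡ N
    c*[N÷c]≡N = trans (*-comm c (N ÷ c)) (p÷q*q≡p N c)

    root≤ : ∀ {τ} → c * τ - N ≤ 0ℚ → N ÷ c ≤ τ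
    root≤ {τ} gτ≤0 = *-cancelˡ-≤-neg c (subst (c * τ ≤_) (sym c*[N÷c]≡N) (p-q≤0⇒p≤q gτ≤0))

    <root : ∀ {τ} → 0ℚ < c * τ - N → τ < N ÷ c
    <root {τ} 0<gτ = *-cancelˡ-<-nonPos c (subst (_< c * τ) (sym c*[N÷c]≡N) (0<q-p⇒p<q 0<gτ))

_⊑_ : Rel (ℚ × ℚ) 0ℓ
_⊑_ = ×-Lex _≡_ _<_ _≤_

⊑-trans : Transitive _⊑_
⊑-trans = ×-transitive {_≈₁_ = _≡_} {_<₁_ = _<_} {_<₂_ = _≤_} isEquivalence <-resp-≡ <-trans ≤-trans

⊑-total : Total _⊑_
⊑-total = ×-total₂ {_≈₁_ = _≡_} {_<₁_ = _<_} {_<₂_ = _≤_} sym <-cmp ≤-total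

⊑⇒proj₁-≤ : ∀ {x y} → x ⊑ y → proj₁ x ≤ proj₁ y
⊑⇒proj₁-≤ (inj₁ x₁<y₁)        = <⇒≤ x₁<y₁
⊑⇒proj₁-≤ (inj₂ (x₁≡y₁ , _)) = ≤-reflexive x₁≡y₁

argmax : ∀ {a ℓ} {A : Set a} {_≼_ : Rel A ℓ} → Transitive _≼_ → Total _≼_ →
         ∀ {n} (f : Fin (suc n) → A) → ∃[ k ] ∀ b → f b ≼ f k
argmax trans total {zero}  f = zero , λ { zero → reduce (total (f zero) (f zero)) }
argmax trans total {suc n} f with argmax trans total (f ∘ suc)
... | k , best with total (f zero) (f (suc k))
...   | inj₁ f0≼fk = suc k , λ { zero → f0≼fk ; (suc b) → best b }
...   | inj₂ fk≼f0 = zero  , λ { zero → reduce (total (f zero) (f zero))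
                               ; (suc b) → trans (best b) fk≼f0 }

finSum-cong : ∀ {n} {f g : Fin n → ℚ} → (∀ k → f k ≡ g k) → finSum f ≡ finSum g
finSum-cong {zero}  f≗g = refl
finSum-cong {suc n} f≗g = cong₂ _+_ (f≗g zero) (finSum-cong (f≗g ∘ suc))

finSum-zero : ∀ {n} {f : Fin n → ℚ} → (∀ k → f k ≡ 0ℚ) → finSum f ≡ 0ℚ
finSum-zero {zero}  f≗0 = refl
finSum-zero {suc n} f≗0 = cong₂ _+_ (f≗0 zero) (finSum-zero (f≗0 ∘ suc))

finSum-punchIn : ∀ {n} (f : Fin (suc n) → ℚ) k → finSum f ≡ f k + finSum (f ∘ punchIn k)
finSum-punchIn f zero = refl
finSum-punchIn {suc n} f (suc k) = begin
    f zero + finSum (f ∘ suc)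
  ≡⟨ cong (f zero +_) (finSum-punchIn (f ∘ suc) k) ⟩
    f zero + (f (suc k) + finSum (f ∘ suc ∘ punchIn k))
  ≡⟨ solve 3 (λ a b c → a :+ (b :+ c) := b :+ (a :+ c)) refl (f zero) (f (suc k)) _ ⟩
    f (suc k) + (f zero + finSum (f ∘ suc ∘ punchIn k))
  ∎
  where open ≡-Reasoning

data PunchInView {n} (k : Fin (suc n)) : Fin (suc n) → Set where
  at       : PunchInView k k
  punchIn′ : ∀ m → PunchInView k (punchIn k m)

punchInView : ∀ {n} (k a : Fin (suc n)) → PunchInView k a
punchInView k a with k ≟ᶠ a
... | yes refl = at
... | no k≢a   = subst (PunchInView k) (punchIn-punchOut k≢a) (punchIn′ _)

insert-self : ∀ {m n} i j (π : Permutation m n) → insert i j π ⟨$⟩ʳ i ≡ j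
insert-self i j π with i ≟ᶠ i
... | yes _ = refl
... | no i≢i = ⊥-elim (i≢i refl)

module Greedy {n : ℕ} (p w : Fin n → ℚ) (p>0 : ∀ j → 0ℚ < p j) where
  open Jobs n p w p>0

  -- Ties in φ are broken in favour of the longer job, which at a crossing of φ_i and φ_j is
  -- the one whose φ is larger afterwards (see gap≡0⇒0≤slope).
  key : (τ : ℚ) → 0ℚ ≤ τ → Fin n → ℚ × ℚ
  key τ 0≤τ j = φ j τ 0≤τ , p j

  -- φ j τ uses its proof of 0 ≤ τ only in an irrelevant instance, so the choice of proof
  -- here is immaterial.
  Prefers : ℚ → Fin n → Fin n → Set
  Prefers τ a b = (0≤τ : 0ℚ ≤ τ) → key τ 0≤τ b ⊑ key τ 0≤τ a

  record IsGreedy (t : ℚ) (π : Permutation′ n) : Set where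
    open Schedule t π
    field
      t≤start       : ∀ a → t ≤ start a
      start+p≤start : ∀ a b → Before a b → start a + p a ≤ start b
      choice        : ∀ a b → Before a b → Prefers (start a) a b

module Prepend {n : ℕ} (p w : Fin (suc n) → ℚ) (p>0 : ∀ j → 0ℚ < p j)
               (t : ℚ) (k : Fin (suc n)) (π′ : Permutation′ n) where

  p′ w′ : Fin n → ℚ
  p′ = p ∘ punchIn k
  w′ = w ∘ punchIn k

  p′>0 : ∀ m → 0ℚ < p′ m
  p′>0 = p>0 ∘ punchIn k

  π : Permutation′ (suc n)
  π = insert k zero π′

  open Jobs.Schedule (suc n) p w p>0 t π
  module Rest = Jobs.Schedule n p′ w′ p′>0 (t + p k) π′

  pos-first : pos k ≡ zero
  pos-first = insert-self k zero π′

  pos-rest : ∀ m → pos (punchIn k m) ≡ suc (Rest.pos m)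
  pos-rest = insert-punchIn k zero π′

  start-first : start k ≡ t
  start-first = trans (cong (t +_) (finSum-zero λ x →
                  cong (λ z → if does (pos x <ᶠ? z) then p x else 0ℚ) pos-first)) (+-identityʳ t)

  start-rest : ∀ m → start (punchIn k m) ≡ Rest.start m
  start-rest m = begin
      t + finSum f
    ≡⟨ cong (t +_) (finSum-punchIn f k) ⟩
      t + (f k + finSum (f ∘ punchIn k))
    ≡⟨ cong (λ z → t + (z + finSum (f ∘ punchIn k))) (f-cong pos-first) ⟩
      t + (p k + finSum (f ∘ punchIn k))
    ≡⟨ sym (+-assoc t (p k) _) ⟩
      t + p k + finSum (f ∘ punchIn k)
    ≡⟨ cong (t + p k +_) (finSum-cong (f-cong ∘ pos-rest)) ⟩
      Rest.start m
    ∎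
    where
    open ≡-Reasoning
    f : Fin (suc n) → ℚ
    f x = if does (pos x <ᶠ? pos (punchIn k m)) then p x else 0ℚ
    f-cong : ∀ {x a} → pos x ≡ a → f x ≡ (if does (a <ᶠ? suc (Rest.pos m)) then p x else 0ℚ)
    f-cong {x} pos-x≡a = cong₂ (λ a b → if does (a <ᶠ? b) then p x else 0ℚ) pos-x≡a (pos-rest m)

  ¬before-first : ∀ a → ¬ Before a k
  ¬before-first a a<k = ℕ.n≮0 (subst (pos a <ᶠ_) pos-first a<k)

  before-rest : ∀ m m′ → Before (punchIn k m) (punchIn k m′) → Rest.Before m m′
  before-rest m m′ before = ℕ.s<s⁻¹ (subst₂ _<ᶠ_ (pos-rest m) (pos-rest m′) before)

  module _ (0≤t : 0ℚ ≤ t) (k-first : ∀ b → Greedy.Prefers p w p>0 t k b)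
           (rest : Greedy.IsGreedy p′ w′ p′>0 (t + p k) π′) where
    open Greedy p w p>0 using (IsGreedy; Prefers)
    module R = Greedy.IsGreedy rest

    t≤start : ∀ a → t ≤ start a
    t≤start a with punchInView k a
    ... | at         = ≤-reflexive (sym start-first)
    ... | punchIn′ m =
      ≤-trans (p≤p+q (<⇒≤ (p>0 k))) (subst (t + p k ≤_) (sym (start-rest m)) (R.t≤start m))

    start+p≤start : ∀ a b → Before a b → start a + p a ≤ start b
    start+p≤start a b a<b with punchInView k a | punchInView k b
    ... | _          | at          = ⊥-elim (¬before-first a a<b)
    ... | at         | punchIn′ m  =
      subst₂ _≤_ (cong (_+ p k) (sym start-first)) (sym (start-rest m)) (R.t≤start m)
    ... | punchIn′ m | punchIn′ m′ =
      subst₂ _≤_ (cong (_+ p′ m) (sym (start-rest m))) (sym (start-rest m′))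
        (R.start+p≤start m m′ (before-rest m m′ a<b))

    choice : ∀ a b → Before a b → Prefers (start a) a b
    choice a b a<b with punchInView k a | punchInView k b
    ... | _          | at          = ⊥-elim (¬before-first a a<b)
    ... | at         | punchIn′ m  =
      subst (λ τ → Prefers τ k (punchIn k m)) (sym start-first) (k-first (punchIn k m))
    ... | punchIn′ m | punchIn′ m′ =
      subst (λ τ → Prefers τ (punchIn k m) (punchIn k m′)) (sym (start-rest m))
        (R.choice m m′ (before-rest m m′ a<b))

    isGreedy : IsGreedy t π
    isGreedy = record { t≤start = t≤start ; start+p≤start = start+p≤start ; choice = choice }

greedy : ∀ n (p w : Fin n → ℚ) (p>0 : ∀ j → 0ℚ < p j) t → 0ℚ ≤ t →
         Σ (Permutation′ n) (Greedy.IsGreedy p w p>0 t)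
greedy zero    p w p>0 t 0≤t = id , record { t≤start = λ () ; start+p≤start = λ () ; choice = λ () }
greedy (suc n) p w p>0 t 0≤t with argmax ⊑-trans ⊑-total (Greedy.key p w p>0 t 0≤t)
... | k , k-best
    with greedy n (p ∘ punchIn k) (w ∘ punchIn k) (p>0 ∘ punchIn k) (t + p k)
                (≤-trans 0≤t (p≤p+q (<⇒≤ (p>0 k))))
...   | π′ , π′-greedy =
  Prepend.π p w p>0 t k π′ , Prepend.isGreedy p w p>0 t k π′ 0≤t (λ b _ → k-best b) π′-greedy

module Crossing {n : ℕ} (p w : Fin n → ℚ) (p>0 : ∀ j → 0ℚ < p j) (w>0 : ∀ j → 0ℚ < w j) where
  open Jobs n p w p>0
  open Greedy p w p>0 using (key)

  d : Fin n → ℚ → ℚ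
  d j s = p j * (p j + s)

  slope offset : Fin n → Fin n → ℚ
  slope  i j = w i * p j - w j * p i
  offset i j = w j * (p i * p i) - w i * (p j * p j)

  -- The numerator of φ i s − φ j s over d i s * d j s; by definition tstar i j is its root.
  gap : Fin n → Fin n → ℚ → ℚ
  gap i j s = slope i j * s - offset i j

  module GapLine i j = Line (slope i j) (offset i j)

  0<d : ∀ j {s} → 0ℚ ≤ s → 0ℚ < d j s
  0<d j 0≤s = *-positive (p>0 j) (+-mono-<-≤ (p>0 j) 0≤s)

  φ*d≡w : ∀ j {s} (0≤s : 0ℚ ≤ s) → φ j s 0≤s * d j s ≡ w j
  φ*d≡w j {s} 0≤s = p÷q*q≡p (w j) (d j s) {{pos⇒nonZero (d j s) {{positive (0<d j 0≤s)}}}}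

  φ*dd≡w*d : ∀ i j {s} (0≤s : 0ℚ ≤ s) → φ i s 0≤s * (d i s * d j s) ≡ w i * d j s
  φ*dd≡w*d i j {s} 0≤s =
    trans (sym (*-assoc (φ i s 0≤s) (d i s) (d j s))) (cong (_* d j s) (φ*d≡w i 0≤s))

  gap≡φ-difference : ∀ i j s (0≤s : 0ℚ ≤ s) →
                     gap i j s ≡ φ i s 0≤s * (d i s * d j s) - φ j s 0≤s * (d i s * d j s)
  gap≡φ-difference i j s 0≤s = begin
      gap i j s
    ≡⟨ solve 5 (λ wi wj pi pj s →
         (wi :* pj :- wj :* pi) :* s :- (wj :* (pi :* pi) :- wi :* (pj :* pj))
         := wi :* (pj :* (pj :+ s)) :- wj :* (pi :* (pi :+ s))) refl (w i) (w j) (p i) (p j) s ⟩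
      w i * d j s - w j * d i s
    ≡⟨ sym (cong₂ _-_ (φ*dd≡w*d i j 0≤s)
                      (trans (cong (φ j s 0≤s *_) (*-comm (d i s) (d j s))) (φ*dd≡w*d j i 0≤s))) ⟩
      φ i s 0≤s * (d i s * d j s) - φ j s 0≤s * (d i s * d j s)
    ∎
    where open ≡-Reasoning

  module Sign i j s (0≤s : 0ℚ ≤ s) =
    SignOfScaledDifference {x = φ i s 0≤s} {y = φ j s 0≤s}
      (*-positive (0<d i 0≤s) (0<d j 0≤s)) (gap≡φ-difference i j s 0≤s)

  gap≡0⇒balanced : ∀ {i j τ} → gap i j τ ≡ 0ℚ → (w i * p j) * (p j + τ) ≡ (w j * p i) * (p i + τ)
  gap≡0⇒balanced {i} {j} {τ} gap≡0 = x∙y⁻¹≈ε⇒x≈y _ _ (trans (sym gap≡difference) gap≡0)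
    where
    gap≡difference : gap i j τ ≡ (w i * p j) * (p j + τ) - (w j * p i) * (p i + τ)
    gap≡difference = solve 5 (λ wi wj pi pj τ →
      (wi :* pj :- wj :* pi) :* τ :- (wj :* (pi :* pi) :- wi :* (pj :* pj))
      := (wi :* pj) :* (pj :+ τ) :- (wj :* pi) :* (pi :+ τ)) refl (w i) (w j) (p i) (p j) τ

  gap≡0⇒slope≤0 : ∀ {i j τ} → 0ℚ ≤ τ → gap i j τ ≡ 0ℚ → p i ≤ p j → slope i j ≤ 0ℚ
  gap≡0⇒slope≤0 {i} {j} {τ} 0≤τ gap≡0 pi≤pj = p≤q⇒p-q≤0
    (*-balance⇒≤ {α = w i * p j} (<⇒≤ (*-positive (w>0 j) (p>0 i)))
      (+-mono-<-≤ (p>0 j) 0≤τ) (+-monoˡ-≤ τ pi≤pj) (gap≡0⇒balanced gap≡0))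

  gap≡0⇒0≤slope : ∀ {i j τ} → 0ℚ ≤ τ → gap i j τ ≡ 0ℚ → p j ≤ p i → 0ℚ ≤ slope i j
  gap≡0⇒0≤slope {i} {j} {τ} 0≤τ gap≡0 pj≤pi = p≤q⇒0≤q-p
    (*-balance⇒≤ {α = w j * p i} (<⇒≤ (*-positive (w>0 i) (p>0 j)))
      (+-mono-<-≤ (p>0 i) 0≤τ) (+-monoˡ-≤ τ pj≤pi) (sym (gap≡0⇒balanced gap≡0)))

  0<gap[0] : ∀ {i j} → φ0 j < φ0 i → 0ℚ < gap i j 0ℚ
  0<gap[0] {i} {j} = Sign.y<x⇒0<g i j 0ℚ ≤-refl

  slope<0 : ∀ {i j} → φ0 j < φ0 i → ¬ DomAll i j → slope i j < 0ℚ
  slope<0 {i} {j} φ0j<φ0i ¬dom = GapLine.¬nonNeg⇒slope<0 i j (0<gap[0] φ0j<φ0i)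
    λ 0≤gap → ¬dom λ s 0≤s → Sign.0≤g⇒y≤x i j s 0≤s (0≤gap s 0≤s)

  dominating⇒same-φ : ∀ {i j τ} (0≤τ : 0ℚ ≤ τ) → DomAll i j →
                      key τ 0≤τ i ⊑ key τ 0≤τ j → SameφOnNonNeg i j
  dominating⇒same-φ 0≤τ dom (inj₁ φi<φj) = ⊥-elim (<⇒≱ φi<φj (dom _ 0≤τ))
  dominating⇒same-φ {i} {j} {τ} 0≤τ dom (inj₂ (φi≡φj , pi≤pj)) s 0≤s =
    Sign.g≡0⇒x≡y i j s 0≤s (GapLine.nonNeg∧vanishing⇒≡0 i j 0≤gap slope≤0 0≤τ gapτ≡0 s)
    where
    0≤gap : ∀ s → 0ℚ ≤ s → 0ℚ ≤ gap i j s
    0≤gap s 0≤s = Sign.y≤x⇒0≤g i j s 0≤s (dom s 0≤s)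
    gapτ≡0 : gap i j τ ≡ 0ℚ
    gapτ≡0 = Sign.x≡y⇒g≡0 i j τ 0≤τ φi≡φj
    slope≤0 : slope i j ≤ 0ℚ
    slope≤0 = gap≡0⇒slope≤0 0≤τ gapτ≡0 pi≤pj

  tstar≤ : ∀ {i j τ} (h : slope i j ≢ 0ℚ) (0≤τ : 0ℚ ≤ τ) → φ0 j < φ0 i →
           φ i τ 0≤τ ≤ φ j τ 0≤τ → tstar i j h ≤ τ
  tstar≤ {i} {j} {τ} h 0≤τ φ0j<φ0i φi≤φj = GapLine.root≤ i j {{≢-nonZero h}} slope<0′ gapτ≤0
    where
    gapτ≤0 : gap i j τ ≤ 0ℚ
    gapτ≤0 = Sign.x≤y⇒g≤0 i j τ 0≤τ φi≤φj
    slope<0′ : slope i j < 0ℚ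
    slope<0′ = GapLine.sign-change⇒slope<0 i j (0<gap[0] φ0j<φ0i) 0≤τ gapτ≤0

  <tstar : ∀ {i j τ} (h : slope i j ≢ 0ℚ) (0≤τ : 0ℚ ≤ τ) → φ0 j < φ0 i → ¬ DomAll i j →
           key τ 0≤τ j ⊑ key τ 0≤τ i → τ < tstar i j h
  <tstar {i} {j} {τ} h 0≤τ φ0j<φ0i ¬dom (inj₁ φj<φi) =
    GapLine.<root i j {{≢-nonZero h}} (slope<0 φ0j<φ0i ¬dom) (Sign.y<x⇒0<g i j τ 0≤τ φj<φi)
  <tstar {i} {j} {τ} h 0≤τ φ0j<φ0i ¬dom (inj₂ (φj≡φi , pj≤pi)) = ⊥-elim (<⇒≱ (slope<0 φ0j<φ0i ¬dom)
    (gap≡0⇒0≤slope 0≤τ (Sign.x≡y⇒g≡0 i j τ 0≤τ (sym φj≡φi)) pj≤pi))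

  greedy⇒partialPotential : ∀ {t π} → 0ℚ ≤ t → Greedy.IsGreedy p w p>0 t π →
                            Schedule.IsPartialPotential t π
  greedy⇒partialPotential {t} {π} 0≤t greedy i j _ = rule-a , rule-b
    where
    open Schedule t π
    open Greedy.IsGreedy greedy

    0≤start : ∀ a → 0ℚ ≤ start a
    0≤start a = ≤-trans 0≤t (t≤start a)

    rule-a : DomAll i j → ¬ SameφOnNonNeg i j → ¬ Before j i
    rule-a dom ¬same j<i = ¬same (dominating⇒same-φ (0≤start j) dom (choice j i j<i (0≤start j)))

    rule-b : ¬ DomAll i j → ¬ DomAll j i → φ0 j < φ0 i → (h : slope i j ≢ 0ℚ) →
               (Before j i → ¬ (start i - p j < tstar i j h))
             × (Before i j → ¬ (tstar i j h ≤ start i))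
    rule-b ¬dom _ φ0j<φ0i h =
        (λ j<i later → <⇒≱ later (≤-trans
            (tstar≤ h (0≤start j) φ0j<φ0i (⊑⇒proj₁-≤ (choice j i j<i (0≤start j))))
            (p+q≤r⇒p≤r-q (start+p≤start j i j<i))))
      , (λ i<j → <⇒≱ (<tstar h (0≤start i) φ0j<φ0i ¬dom (choice i j i<j (0≤start i))))

lemma6 : (n : ℕ) (p w : Fin n → ℚ) (p>0 : ∀ j → 0ℚ < p j) (w>0 : ∀ j → 0ℚ < w j)
         (t : ℚ) → 0ℚ ≤ t →
         Σ (Permutation′ n) (λ π → Jobs.Schedule.IsPartialPotential n p w p>0 t π)
lemma6 n p w p>0 w>0 t 0≤t =
  map₂ (Crossing.greedy⇒partialPotential p w p>0 w>0 0≤t) (greedy n p w p>0 t 0≤t)
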